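{- Let $G$ and $H$ be finite simple graphs and let $u\in V(G)$, $v\in V(H)$. Then \[\mathrm{dp}_{G\times H}((u,v))=x^{\deg_G u}\,\mathrm{dp}_H(v)+x^{\deg_H v}\,\mathrm{dp}_G(u).\]
   Context: For a vertex $w$ of a simple graph $\Gamma$, the degree polynomial $\mathrm{dp}_\Gamma(w)$ is the polynomial whose coefficient of $x^{i}$ is the number of neighbours of $w$ having degree $i$ in $\Gamma$ ($0$ if $w$ is isolated). Here $G\times H$ denotes the Cartesian product: the simple graph on $V(G)\times V(H)$ in which $(u_1,v_1)\sim(u_2,v_2)$ iff either $u_1=u_2$ and $v_1\sim v_2$ in $H$, or $v_1=v_2$ and $u_1\sim u_2$ in $G$. -}

module Defs where

open import Data.Nat using (ℕ; zero; suc; _+_; _*_; _∸_; _≤ᵇ_; _≡ᵇ_)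
open import Data.Bool using (Bool; true; false; if_then_else_; _∧_; _∨_)
open import Data.Fin using (Fin; zero; suc; remQuot; _≟_)
open import Data.Product using (_×_; _,_; proj₁; proj₂)
open import Relation.Binary.PropositionalEquality using (_≡_; refl) renaming (sym to ≡-sym)
open import Relation.Nullary using (yes; no)
open import Data.Empty using (⊥-elim)
open import Data.Bool.Properties using (∧-zeroʳ)
open import Relation.Nullary.Decidable using (⌊_⌋)

∑ : ∀ {n} → (Fin n → ℕ) → ℕ
∑ {zero}  f = 0
∑ {suc n} f = f zero + ∑ (λ i → f (suc i))

count : ∀ {n} → (Fin n → Bool) → ℕ
count p = ∑ (λ i → if p i then 1 else 0)

record Graph (n : ℕ) : Set where
  field
    adj    : Fin n → Fin n → Bool
    sym    : ∀ u v → adj u v ≡ adj v u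
    irrefl : ∀ u → adj u u ≡ false
open Graph public

deg : ∀ {n} → Graph n → Fin n → ℕ
deg Γ w = count (adj Γ w)

-- Polynomials with ℕ coefficients, as coefficient sequences
-- (coefficient of x^i at index i); equality is coefficientwise.
Poly : Set
Poly = ℕ → ℕ

_≈P_ : Poly → Poly → Set
p ≈P q = ∀ i → p i ≡ q i

_+P_ : Poly → Poly → Poly
(p +P q) i = p i + q i

xpow*_ : ℕ → Poly → Poly
xpow*_ d p i = if d ≤ᵇ i then p (i ∸ d) else 0

dp : ∀ {n} → Graph n → Fin n → Poly
dp Γ w i = count (λ z → adj Γ w z ∧ (deg Γ z ≡ᵇ i))

-- Cartesian product on Fin (m * n), vertex k ↔ (u , v) = remQuot n k
-- (bijection Fin (m * n) ≃ Fin m × Fin n, inverse combine).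
adj× : ∀ {m n} → Graph m → Graph n → Fin m × Fin n → Fin m × Fin n → Bool
adj× G H (u₁ , v₁) (u₂ , v₂) =
  (⌊ u₁ ≟ u₂ ⌋ ∧ adj H v₁ v₂) ∨ (⌊ v₁ ≟ v₂ ⌋ ∧ adj G u₁ u₂)

prodAdj : ∀ {m n} → Graph m → Graph n → Fin (m * n) → Fin (m * n) → Bool
prodAdj {m} {n} G H a b = adj× G H (remQuot {m} n a) (remQuot {m} n b)

private
  ≟-sym : ∀ {k} (a b : Fin k) → ⌊ a ≟ b ⌋ ≡ ⌊ b ≟ a ⌋
  ≟-sym a b with a ≟ b | b ≟ a
  ... | yes _ | yes _ = refl
  ... | no _  | no _  = refl
  ... | yes p | no ¬q = ⊥-elim (¬q (≡-sym p))
  ... | no ¬p | yes q = ⊥-elim (¬p (≡-sym q))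

adj×-sym : ∀ {m n} (G : Graph m) (H : Graph n) p q → adj× G H p q ≡ adj× G H q p
adj×-sym G H (u₁ , v₁) (u₂ , v₂)
  rewrite ≟-sym u₁ u₂ | sym H v₁ v₂ | ≟-sym v₁ v₂ | sym G u₁ u₂ = refl

adj×-irrefl : ∀ {m n} (G : Graph m) (H : Graph n) p → adj× G H p p ≡ false
adj×-irrefl G H (u , v) rewrite irrefl H v | irrefl G u
  rewrite ∧-zeroʳ ⌊ u ≟ u ⌋ | ∧-zeroʳ ⌊ v ≟ v ⌋ = refl

prodAdj-sym : ∀ {m n} (G : Graph m) (H : Graph n) a b →
              prodAdj G H a b ≡ prodAdj G H b a
prodAdj-sym {m} {n} G H a b = adj×-sym G H (remQuot {m} n a) (remQuot {m} n b)

prodAdj-irrefl : ∀ {m n} (G : Graph m) (H : Graph n) a → prodAdj G H a a ≡ false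
prodAdj-irrefl {m} {n} G H a = adj×-irrefl G H (remQuot {m} n a)

_□_ : ∀ {m n} → Graph m → Graph n → Graph (m * n)
G □ H = record { adj = prodAdj G H ; sym = prodAdj-sym G H ; irrefl = prodAdj-irrefl G H }

-- The neighbourhood of (u , v) in G □ H is the disjoint union of {u} × N_H(v) and
-- N_G(u) × {v}, and a vertex (i , j) has degree deg_G i + deg_H j. So the neighbours
-- (u , j) contribute deg_H j shifted by deg_G u, i.e. x^(deg_G u) dp_H(v), and the
-- neighbours (i , v) contribute x^(deg_H v) dp_G(u).
module Submission where

open import Defs
open import Data.Nat using (ℕ; zero; suc; _+_; _*_; _≡ᵇ_)
open import Data.Nat.Properties using (+-assoc; +-comm; +-identityʳ; +-commutativeSemigroup)
open import Algebra.Properties.CommutativeSemigroup +-commutativeSemigroup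
  using () renaming (interchange to +-interchange)
open import Data.Fin using (Fin; zero; suc; combine; remQuot; _↑ˡ_; _↑ʳ_)
open import Data.Fin.Properties using (_≟_; remQuot-combine)
open import Data.Bool using (Bool; true; false; if_then_else_; _∧_)
open import Data.Bool.Properties using (∧-zeroʳ)
open import Data.Product using (_,_)
open import Relation.Binary.PropositionalEquality
  using (_≡_; refl; cong; cong₂; trans; module ≡-Reasoning) renaming (sym to ≡-sym)
open import Relation.Nullary using (yes; no)
open import Relation.Nullary.Decidable using (⌊_⌋)

ind : Bool → ℕ
ind b = if b then 1 else 0

∑-cong : ∀ {n} {f g : Fin n → ℕ} → (∀ i → f i ≡ g i) → ∑ f ≡ ∑ g
∑-cong {zero}  f≡g = refl
∑-cong {suc n} f≡g = cong₂ _+_ (f≡g zero) (∑-cong (λ i → f≡g (suc i)))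

∑-zero : ∀ n → ∑ {n} (λ _ → 0) ≡ 0
∑-zero zero    = refl
∑-zero (suc n) = ∑-zero n

∑-distrib-+ : ∀ {n} (f g : Fin n → ℕ) → ∑ (λ i → f i + g i) ≡ ∑ f + ∑ g
∑-distrib-+ {zero}  f g = refl
∑-distrib-+ {suc n} f g =
  trans (cong (f zero + g zero +_) (∑-distrib-+ (λ i → f (suc i)) (λ i → g (suc i))))
        (+-interchange (f zero) (g zero) _ _)

∑-if : ∀ {n} (b : Bool) (f : Fin n → ℕ) →
       ∑ (λ i → if b then f i else 0) ≡ (if b then ∑ f else 0)
∑-if     true  f = refl
∑-if {n} false f = ∑-zero n

∑-δ : ∀ {n} (u : Fin n) (f : Fin n → ℕ) → ∑ (λ i → if ⌊ u ≟ i ⌋ then f i else 0) ≡ f u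
∑-δ {suc n} zero    f = trans (cong (f zero +_) (∑-zero n)) (+-identityʳ (f zero))
∑-δ {suc n} (suc u) f = trans (∑-cong suc≟suc) (∑-δ u (λ i → f (suc i)))
  where
  suc≟suc : ∀ i → (if ⌊ suc u ≟ suc i ⌋ then f (suc i) else 0)
                ≡ (if ⌊ u ≟ i ⌋ then f (suc i) else 0)
  suc≟suc i with u ≟ i
  ... | yes _ = refl
  ... | no  _ = refl

∑-++ : ∀ m n (f : Fin (m + n) → ℕ) → ∑ f ≡ ∑ (λ i → f (i ↑ˡ n)) + ∑ (λ j → f (m ↑ʳ j))
∑-++ zero    n f = refl
∑-++ (suc m) n f = trans (cong (f zero +_) (∑-++ m n (λ i → f (suc i))))
                         (≡-sym (+-assoc (f zero) _ _))

∑-combine : ∀ m n (f : Fin (m * n) → ℕ) → ∑ f ≡ ∑ (λ i → ∑ (λ j → f (combine {m} {n} i j)))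
∑-combine zero    n f = refl
∑-combine (suc m) n f =
  trans (∑-++ n (m * n) f) (cong (∑ (λ j → f (j ↑ˡ m * n)) +_) (∑-combine m n (λ k → f (n ↑ʳ k))))

count-∧ : ∀ {n} (p q : Fin n → Bool) → count (λ i → p i ∧ q i) ≡ ∑ (λ i → if p i then ind (q i) else 0)
count-∧ p q = ∑-cong (λ i → ind-∧ (p i) (q i))
  where
  ind-∧ : ∀ a b → ind (a ∧ b) ≡ (if a then ind b else 0)
  ind-∧ true  b = refl
  ind-∧ false b = refl

if-∧ : ∀ a b {x : ℕ} → (if a ∧ b then x else 0) ≡ (if a then (if b then x else 0) else 0)
if-∧ true  b = refl
if-∧ false b = refl

∑²-δˡ : ∀ {m n} (u : Fin m) (p : Fin n → Bool) (f : Fin m → Fin n → ℕ) →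
  ∑ (λ i → ∑ (λ j → if ⌊ u ≟ i ⌋ ∧ p j then f i j else 0)) ≡ ∑ (λ j → if p j then f u j else 0)
∑²-δˡ u p f = trans (∑-cong (λ i → trans (∑-cong (λ j → if-∧ ⌊ u ≟ i ⌋ (p j)))
                                          (∑-if ⌊ u ≟ i ⌋ (λ j → if p j then f i j else 0))))
                    (∑-δ u (λ i → ∑ (λ j → if p j then f i j else 0)))

∑²-δʳ : ∀ {m n} (v : Fin n) (p : Fin m → Bool) (f : Fin m → Fin n → ℕ) →
  ∑ (λ i → ∑ (λ j → if ⌊ v ≟ j ⌋ ∧ p i then f i j else 0)) ≡ ∑ (λ i → if p i then f i v else 0)
∑²-δʳ v p f = ∑-cong (λ i → trans (∑-cong (λ j → if-∧ ⌊ v ≟ j ⌋ (p i)))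
                                  (∑-δ v (λ j → if p i then f i j else 0)))

module _ {m n} (G : Graph m) (H : Graph n) where

  -- The two disjuncts of adj× never hold together, because G and H are irreflexive.
  if-adj×-split : ∀ u i v j (x : ℕ) →
    (if adj× G H (u , v) (i , j) then x else 0)
      ≡ (if ⌊ u ≟ i ⌋ ∧ adj H v j then x else 0) + (if ⌊ v ≟ j ⌋ ∧ adj G u i then x else 0)
  if-adj×-split u i v j x with u ≟ i | v ≟ j
  ... | yes refl | yes refl rewrite irrefl H v | irrefl G u = refl
  ... | no  _    | _        = refl
  ... | yes refl | no _ with adj H v j
  ...   | true  = ≡-sym (+-identityʳ x)
  ...   | false = refl

  ∑²-adj× : ∀ u v (f : Fin m → Fin n → ℕ) →
    ∑ (λ i → ∑ (λ j → if adj× G H (u , v) (i , j) then f i j else 0))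
      ≡ ∑ (λ j → if adj H v j then f u j else 0) + ∑ (λ i → if adj G u i then f i v else 0)
  ∑²-adj× u v f = begin
    ∑ (λ i → ∑ (λ j → if adj× G H (u , v) (i , j) then f i j else 0))
      ≡⟨ ∑-cong (λ i → trans (∑-cong (λ j → if-adj×-split u i v j (f i j))) (∑-distrib-+ {n} _ _)) ⟩
    ∑ (λ i → ∑ (λ j → if ⌊ u ≟ i ⌋ ∧ adj H v j then f i j else 0)
           + ∑ (λ j → if ⌊ v ≟ j ⌋ ∧ adj G u i then f i j else 0))
      ≡⟨ ∑-distrib-+ {m} _ _ ⟩
    ∑ (λ i → ∑ (λ j → if ⌊ u ≟ i ⌋ ∧ adj H v j then f i j else 0))
      + ∑ (λ i → ∑ (λ j → if ⌊ v ≟ j ⌋ ∧ adj G u i then f i j else 0))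
      ≡⟨ cong₂ _+_ (∑²-δˡ u (adj H v) f) (∑²-δʳ v (adj G u) f) ⟩
    ∑ (λ j → if adj H v j then f u j else 0) + ∑ (λ i → if adj G u i then f i v else 0) ∎
    where open ≡-Reasoning

  ∑-□-neighbours : ∀ u v (g : Fin (m * n) → ℕ) →
    ∑ (λ k → if adj (G □ H) (combine u v) k then g k else 0)
      ≡ ∑ (λ j → if adj H v j then g (combine u j) else 0) + ∑ (λ i → if adj G u i then g (combine i v) else 0)
  ∑-□-neighbours u v g = begin
    ∑ (λ k → if adj (G □ H) (combine u v) k then g k else 0)
      ≡⟨ ∑-combine m n _ ⟩
    ∑ {m} (λ i → ∑ {n} (λ j → if adj× G H (remQuot {m} n (combine u v)) (remQuot {m} n (combine i j))
                                then g (combine i j) else 0))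
      ≡⟨ ∑-cong {m} (λ i → ∑-cong {n} (λ j → cong₂ (λ p q → if adj× G H p q then g (combine i j) else 0)
                                           (remQuot-combine u v) (remQuot-combine i j))) ⟩
    ∑ (λ i → ∑ (λ j → if adj× G H (u , v) (i , j) then g (combine i j) else 0))
      ≡⟨ ∑²-adj× u v (λ i j → g (combine i j)) ⟩
    ∑ (λ j → if adj H v j then g (combine u j) else 0) + ∑ (λ i → if adj G u i then g (combine i v) else 0) ∎
    where open ≡-Reasoning

  deg-□ : ∀ u v → deg (G □ H) (combine u v) ≡ deg G u + deg H v
  deg-□ u v = trans (∑-□-neighbours u v (λ _ → 1)) (+-comm (deg H v) (deg G u))

xpow*-suc : ∀ a (p : Poly) d → (xpow* suc a) p (suc d) ≡ (xpow* a) p d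
xpow*-suc zero    p d = refl
xpow*-suc (suc a) p d = refl

count-shift : ∀ {n} (X : Fin n → Bool) (D : Fin n → ℕ) a →
  (λ d → count (λ j → X j ∧ (a + D j ≡ᵇ d))) ≈P (xpow* a) (λ d → count (λ j → X j ∧ (D j ≡ᵇ d)))
count-shift {n} X D zero    d       = refl
count-shift {n} X D (suc a) zero    = trans (∑-cong (λ j → cong ind (∧-zeroʳ (X j)))) (∑-zero n)
count-shift {n} X D (suc a) (suc d) =
  trans (count-shift X D a d) (≡-sym (xpow*-suc a (λ e → count (λ j → X j ∧ (D j ≡ᵇ e))) d))

theorem4p16 : ∀ {m n} (G : Graph m) (H : Graph n) (u : Fin m) (v : Fin n) →
    dp (G □ H) (combine u v) ≈P ((xpow* (deg G u)) (dp H v) +P (xpow* (deg H v)) (dp G u))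
theorem4p16 G H u v d = begin
  dp (G □ H) (combine u v) d
    ≡⟨ count-∧ (adj (G □ H) (combine u v)) (λ k → deg (G □ H) k ≡ᵇ d) ⟩
  ∑ (λ k → if adj (G □ H) (combine u v) k then ind (deg (G □ H) k ≡ᵇ d) else 0)
    ≡⟨ ∑-□-neighbours G H u v _ ⟩
  ∑ (λ j → if adj H v j then ind (deg (G □ H) (combine u j) ≡ᵇ d) else 0)
    + ∑ (λ i → if adj G u i then ind (deg (G □ H) (combine i v) ≡ᵇ d) else 0)
    ≡⟨ cong₂ _+_ (∑-cong (λ j → cong (λ t → if adj H v j then ind (t ≡ᵇ d) else 0) (deg-□ G H u j)))
                 (∑-cong (λ i → cong (λ t → if adj G u i then ind (t ≡ᵇ d) else 0)
                                     (trans (deg-□ G H i v) (+-comm (deg G i) (deg H v))))) ⟩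
  ∑ (λ j → if adj H v j then ind (deg G u + deg H j ≡ᵇ d) else 0)
    + ∑ (λ i → if adj G u i then ind (deg H v + deg G i ≡ᵇ d) else 0)
    ≡⟨ ≡-sym (cong₂ _+_ (count-∧ (adj H v) (λ j → deg G u + deg H j ≡ᵇ d))
                        (count-∧ (adj G u) (λ i → deg H v + deg G i ≡ᵇ d))) ⟩
  count (λ j → adj H v j ∧ (deg G u + deg H j ≡ᵇ d))
    + count (λ i → adj G u i ∧ (deg H v + deg G i ≡ᵇ d))
    ≡⟨ cong₂ _+_ (count-shift (adj H v) (deg H) (deg G u) d)
                 (count-shift (adj G u) (deg G) (deg H v) d) ⟩
  (xpow* (deg G u)) (dp H v) d + (xpow* (deg H v)) (dp G u) d ∎
  where open ≡-Reasoning
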